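{- Let $G$ be a plane graph containing no cycle of length 4, and let $H$ be the subgraph of $G$ formed by the edges in $\Gamma(G)$ (and their endpoints). (i) If $G$ is 4-regular, then either $\tau(G)=0$ or $\tau(G)\ge 5$. (ii) If $G$ is 4-regular and $\tau(G)=5$, then $H$ is a cycle of length 5. (iii) If $\delta(G)\ge 4$ and there is an edge $uv\in\Gamma(G)$ with $d_G(u)=4$, then there is an edge $uw\in\Gamma(G)$ with $w\ne v$.
   Context: All graphs are simple. A plane graph is a planar graph together with an embedding in the plane. $\Gamma(G)$ denotes the set of edges of $G$ that are not contained in any triangle of $G$, and $\tau(G)=|\Gamma(G)|$. $\delta(G)$ is the minimum degree and $d_G(u)$ the degree of $u$. -}

module Defs where

open import Data.Nat using (ℕ; zero; suc; _+_; _*_; _≤_; _<ᵇ_; _≤ᵇ_; _≡ᵇ_)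
open import Data.Fin using (Fin; toℕ)
open import Data.Fin.Properties using (_≟_)
open import Data.Bool using (Bool; true; false; _∧_; _∨_; not; if_then_else_)
open import Data.Product using (Σ; ∃; _×_; _,_)
open import Data.Sum using (_⊎_)
open import Function using (_∘_)
open import Relation.Binary.PropositionalEquality using (_≡_; _≢_)
open import Relation.Nullary using (¬_)
open import Relation.Nullary.Decidable using (⌊_⌋)

record Graph (n : ℕ) : Set where
  field
    adj        : Fin n → Fin n → Bool
    adj-sym    : ∀ u v → adj u v ≡ adj v u
    adj-irrefl : ∀ u → adj u u ≡ false

countF : ∀ {n} → (Fin n → Bool) → ℕ
countF {zero}  p = 0
countF {suc n} p = (if p Fin.zero then 1 else 0) + countF (p ∘ Fin.suc)

sumF : ∀ {n} → (Fin n → ℕ) → ℕ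
sumF {zero}  f = 0
sumF {suc n} f = f Fin.zero + sumF (f ∘ Fin.suc)

anyF : ∀ {n} → (Fin n → Bool) → Bool
anyF {zero}  p = false
anyF {suc n} p = p Fin.zero ∨ anyF (p ∘ Fin.suc)

allN : ℕ → (ℕ → Bool) → Bool
allN zero    p = true
allN (suc m) p = allN m p ∧ p m

iter : ∀ {A : Set} → (A → A) → ℕ → A → A
iter f zero    x = x
iter f (suc k) x = f (iter f k x)

module _ {n : ℕ} (G : Graph n) where
  open Graph G

  Adj : Fin n → Fin n → Set
  Adj u v = adj u v ≡ true

  deg : Fin n → ℕ
  deg u = countF (adj u)

  MinDegAtLeast : ℕ → Set
  MinDegAtLeast k = ∀ u → k ≤ deg u

  FourRegular : Set
  FourRegular = ∀ u → deg u ≡ 4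

  inTriangle : Fin n → Fin n → Bool
  inTriangle u v = anyF (λ w → adj u w ∧ adj v w)

  gamma : Fin n → Fin n → Bool
  gamma u v = adj u v ∧ not (inTriangle u v)

  InΓ : Fin n → Fin n → Set
  InΓ u v = gamma u v ≡ true

  edgeCount : ℕ
  edgeCount = sumF (λ u → countF (λ v → (toℕ u <ᵇ toℕ v) ∧ adj u v))

  tau : ℕ
  tau = sumF (λ u → countF (λ v → (toℕ u <ᵇ toℕ v) ∧ gamma u v))

  HasC4 : Set
  HasC4 = Σ (Fin n) λ a → Σ (Fin n) λ b → Σ (Fin n) λ c → Σ (Fin n) λ d →
    (a ≢ b × a ≢ c × a ≢ d × b ≢ c × b ≢ d × c ≢ d) ×
    (Adj a b × Adj b c × Adj c d × Adj d a)

  C4Free : Set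
  C4Free = ¬ HasC4

  -- H (the subgraph formed by the edges of Γ(G) and their endpoints)
  -- is a cycle of length 5: there are five distinct vertices
  -- v₀ … v₄ such that the edge set Γ(G) is exactly
  -- {v₀v₁, v₁v₂, v₂v₃, v₃v₄, v₄v₀} (the vertex set of H is then
  -- exactly {v₀,…,v₄}).
  cyc5 : Fin 5 → Fin 5
  cyc5 Fin.zero = Fin.suc Fin.zero
  cyc5 (Fin.suc Fin.zero) = Fin.suc (Fin.suc Fin.zero)
  cyc5 (Fin.suc (Fin.suc Fin.zero)) = Fin.suc (Fin.suc (Fin.suc Fin.zero))
  cyc5 (Fin.suc (Fin.suc (Fin.suc Fin.zero))) = Fin.suc (Fin.suc (Fin.suc (Fin.suc Fin.zero)))
  cyc5 (Fin.suc (Fin.suc (Fin.suc (Fin.suc Fin.zero)))) = Fin.zero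

  ΓIsC5 : Set
  ΓIsC5 = Σ (Fin 5 → Fin n) λ v →
    (∀ i j → v i ≡ v j → i ≡ j) ×
    (∀ x y → InΓ x y → ∃ λ i → (x ≡ v i × y ≡ v (cyc5 i)) ⊎ (y ≡ v i × x ≡ v (cyc5 i))) ×
    (∀ i → InΓ (v i) (v (cyc5 i)))

  -- Planarity, combinatorially (Heffter–Edmonds–Ringel): G admits a
  -- rotation system whose face count satisfies Euler's formula with
  -- genus 0 on every component.

  -- σ u is a cyclic permutation of the neighbourhood N(u):
  -- it maps N(u) into N(u) and N(u) is a single σ u-orbit.
  IsRotation : (Fin n → Fin n → Fin n) → Set
  IsRotation σ =
    (∀ u v → Adj u v → Adj u (σ u v)) ×
    (∀ u v w → Adj u v → Adj u w → ∃ λ k → iter (σ u) k v ≡ w)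

  module _ (σ : Fin n → Fin n → Fin n) where
    -- face-tracing permutation on darts
    φ : Fin n × Fin n → Fin n × Fin n
    φ (u , v) = v , σ v u

    code : Fin n × Fin n → ℕ
    code (u , v) = toℕ u * n + toℕ v

    -- dart d is the code-minimal dart of its φ-orbit
    -- (orbits have length ≤ n * n)
    orbitMin : Fin n × Fin n → Bool
    orbitMin d = allN (suc (n * n)) (λ k → code d ≤ᵇ code (iter φ k d))

    -- number of faces = number of φ-orbits on darts
    faces : ℕ
    faces = sumF (λ u → countF (λ v → adj u v ∧ orbitMin (u , v)))

  reach : ℕ → Fin n → Fin n → Bool
  reach zero    u w = ⌊ u ≟ w ⌋
  reach (suc k) u w = reach k u w ∨ anyF (λ x → reach k u x ∧ adj x w)

  -- number of connected components (count least vertex of each component)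
  components : ℕ
  components = countF (λ u → not (anyF (λ w → (toℕ w <ᵇ toℕ u) ∧ reach n w u)))

  isolated : ℕ
  isolated = countF (λ u → deg u ≡ᵇ 0)

  -- Σ over components of (V_i − E_i + F_i) = 2 · #components,
  -- where an isolated vertex counts as having one face.
  Planar : Set
  Planar = Σ (Fin n → Fin n → Fin n) λ σ →
    IsRotation σ × (n + faces σ + isolated ≡ 2 * components + edgeCount)

{-# OPTIONS --safe #-}
-- If uv ∈ Γ(G) and d(u) = 4, the three other neighbours of u
-- cannot all lie in triangles with u: a triangle through ua cannot use v (uv would lie in
-- it), so each of them would be adjacent to another of them, and some vertex among them
-- would then share two neighbours with u, giving a 4-cycle.  Hence in the 4-regular case
-- every Γ-edge continues into a non-backtracking walk of Γ-edges; C4-freeness and the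
-- absence of triangles among Γ-edges make any five consecutive vertices of such a walk
-- distinct, so a walk with six vertices has five distinct edges.  If τ(G) = 5 the walk must
-- close up after five steps, and then no further Γ-edge fits.
module Submission where

open import Defs
open import Data.Bool using (Bool; true; false; _∧_; not; if_then_else_; T)
open import Data.Bool.Properties using (∧-conicalˡ; ∧-conicalʳ; T-≡)
open import Data.Empty using (⊥; ⊥-elim)
open import Data.Fin using (Fin; zero; suc; toℕ)
open import Data.Fin.Properties using (_≟_; toℕ-injective)
open import Data.List using (List; []; _∷_; length; lookup; map)
open import Data.List.Properties using (length-map)
open import Data.List.Membership.Propositional.Properties using (∈-lookup)
open import Data.List.Relation.Unary.All as All using (All; []; _∷_)
open import Data.List.Relation.Unary.All.Properties as All using (¬Any⇒All¬)
open import Data.List.Relation.Unary.AllPairs as AllPairs using (AllPairs; []; _∷_)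
import Data.List.Relation.Unary.AllPairs.Properties as AllPairs
open import Data.List.Relation.Unary.Any as Any using (here; there)
open import Data.Nat using (ℕ; zero; suc; _+_; _≤_; _<_; _<ᵇ_; z≤n; s≤s)
open import Data.Nat.Properties using (suc-injective; +-suc; 0≢1+n; <-irrefl; ≮⇒≥; ≤∧≢⇒<; <⇒<ᵇ)
open import Data.Product using (Σ; ∃; ∃₂; _×_; _,_; proj₁; proj₂; uncurry)
open import Data.Sum using (_⊎_; inj₁; inj₂)
open import Data.Vec using (Vec; []; _∷_)
import Data.Vec.Membership.Propositional as VecMembership
open import Data.Vec.Relation.Unary.All as VecAll using ([]; _∷_)
open import Data.Vec.Relation.Unary.AllPairs as VecAllPairs using ([]; _∷_)
open import Data.Vec.Relation.Unary.Any using (here; there)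
open import Function using (_∘_)
open import Function.Bundles using (Equivalence)
open import Relation.Binary.PropositionalEquality
  using (_≡_; _≢_; refl; sym; trans; cong; subst; ≢-sym)
open import Relation.Nullary using (¬_; Dec; does; yes; no)
open import Relation.Nullary.Decidable using (_×-dec_; _⊎-dec_)

∧-intro : ∀ {x y} → x ≡ true → y ≡ true → x ∧ y ≡ true
∧-intro refl refl = refl

anyF-witness : ∀ {n} (p : Fin n → Bool) → anyF p ≡ true → ∃ λ x → p x ≡ true
anyF-witness {suc n} p h with p zero in p₀
... | true  = zero , p₀
... | false = let x , px = anyF-witness (p ∘ suc) h in suc x , px

anyF-intro : ∀ {n} (p : Fin n → Bool) {x} → p x ≡ true → anyF p ≡ true
anyF-intro p {zero} px rewrite px = refl
anyF-intro p {suc x} px with p zero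
... | true  = refl
... | false = anyF-intro (p ∘ suc) px

-- Written with `does` rather than ⌊_⌋ so that `without p (suc a) ∘ suc` reduces to
-- `without (p ∘ suc) a`, which the counting proofs below rely on definitionally.
without : ∀ {n} → (Fin n → Bool) → Fin n → Fin n → Bool
without p a x = not (does (x ≟ a)) ∧ p x

without-true : ∀ {n} (p : Fin n → Bool) {a x} → without p a x ≡ true → x ≢ a × p x ≡ true
without-true p {a} {x} h with x ≟ a
... | no x≢a = x≢a , h

without-intro : ∀ {n} (p : Fin n → Bool) {a x} → x ≢ a → p x ≡ true → without p a x ≡ true
without-intro p {a} {x} x≢a px with x ≟ a
... | yes x≡a = ⊥-elim (x≢a x≡a)
... | no _    = px

countF-witness : ∀ {n} (p : Fin n → Bool) {k} → countF p ≡ suc k → ∃ λ x → p x ≡ true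
countF-witness {suc n} p c with p zero in p₀
... | true  = zero , p₀
... | false = let x , px = countF-witness (p ∘ suc) c in suc x , px

countF-without : ∀ {n} (p : Fin n → Bool) a → p a ≡ true → countF p ≡ suc (countF (without p a))
countF-without p zero    pa rewrite pa = refl
countF-without p (suc a) pa =
  trans (cong ((if p zero then 1 else 0) +_) (countF-without (p ∘ suc) a pa)) (+-suc _ _)

enumerate : ∀ {n} (p : Fin n → Bool) k → countF p ≡ k →
  Σ (Vec (Fin n) k) λ xs →
    VecAllPairs.AllPairs _≢_ xs × VecAll.All (λ x → p x ≡ true) xs ×
    (∀ {x} → p x ≡ true → x VecMembership.∈ xs)
enumerate p zero c =
  [] , [] , [] , λ {x} px → ⊥-elim (0≢1+n (trans (sym c) (countF-without p x px)))
enumerate p (suc k) c with countF-witness p c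
... | a , pa with enumerate (without p a) k (suc-injective (trans (sym (countF-without p a pa)) c))
... | xs , distinct , sat , complete =
  a ∷ xs ,
  VecAll.map (≢-sym ∘ proj₁ ∘ without-true p) sat ∷ distinct ,
  pa ∷ VecAll.map (proj₂ ∘ without-true p) sat ,
  complete′
  where
  complete′ : ∀ {x} → p x ≡ true → x VecMembership.∈ a ∷ xs
  complete′ {x} px with x ≟ a
  ... | yes refl = here refl
  ... | no x≢a   = there (complete (without-intro p x≢a px))

pairCount : ∀ {n m} → (Fin n → Fin m → Bool) → ℕ
pairCount Q = sumF (λ u → countF (Q u))

without₂ : ∀ {n m} → (Fin n → Fin m → Bool) → Fin n → Fin m → Fin n → Fin m → Bool
without₂ Q a b u v = not (does (u ≟ a) ∧ does (v ≟ b)) ∧ Q u v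

without₂-keeps : ∀ {n m} (Q : Fin n → Fin m → Bool) {a b} {e} →
  (a , b) ≢ e → uncurry Q e ≡ true → uncurry (without₂ Q a b) e ≡ true
without₂-keeps Q {a} {b} {c , d} ne q with c ≟ a | d ≟ b
... | yes refl | yes refl = ⊥-elim (ne refl)
... | yes _    | no _     = q
... | no _     | _        = q

pairCount-without : ∀ {n m} (Q : Fin n → Fin m → Bool) a b → Q a b ≡ true →
  pairCount Q ≡ suc (pairCount (without₂ Q a b))
pairCount-without Q zero    b q = cong (_+ pairCount (Q ∘ suc)) (countF-without (Q zero) b q)
pairCount-without Q (suc a) b q =
  trans (cong (countF (Q zero) +_) (pairCount-without (Q ∘ suc) a b q)) (+-suc _ _)

pairCount-witness : ∀ {n m} (Q : Fin n → Fin m → Bool) {k} →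
  pairCount Q ≡ suc k → ∃₂ λ a b → Q a b ≡ true
pairCount-witness {suc n} Q c with countF (Q zero) in c₀
... | suc _ = zero , countF-witness (Q zero) c₀
... | zero  = let a , b , q = pairCount-witness (Q ∘ suc) c in suc a , b , q

length≤pairCount : ∀ {n m} (Q : Fin n → Fin m → Bool) (ps : List (Fin n × Fin m)) →
  All (λ e → uncurry Q e ≡ true) ps → AllPairs _≢_ ps → length ps ≤ pairCount Q
length≤pairCount Q []             []       []                 = z≤n
length≤pairCount Q ((a , b) ∷ ps) (q ∷ qs) (new ∷ distinct) rewrite pairCount-without Q a b q =
  s≤s (length≤pairCount (without₂ Q a b) ps
        (All.zipWith (λ (ne , q′) → without₂-keeps Q ne q′) (new , qs)) distinct)

lookup-injective : ∀ {A : Set} {xs : List A} → AllPairs _≢_ xs →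
  ∀ i j → lookup xs i ≡ lookup xs j → i ≡ j
lookup-injective (_ ∷ _)        zero    zero    _  = refl
lookup-injective (x∉xs ∷ _)     zero    (suc j) eq = ⊥-elim (All.lookup x∉xs (∈-lookup j) eq)
lookup-injective (x∉xs ∷ _)     (suc i) zero    eq = ⊥-elim (All.lookup x∉xs (∈-lookup i) (sym eq))
lookup-injective (_ ∷ distinct) (suc i) (suc j) eq = cong suc (lookup-injective distinct i j eq)

Edge : ℕ → Set
Edge n = Fin n × Fin n

module _ {n : ℕ} where

  -- The orientation of the disjuncts matches the one used in ΓIsC5.
  SameEdge : Edge n → Edge n → Set
  SameEdge (x , y) (a , b) = (x ≡ a × y ≡ b) ⊎ (y ≡ a × x ≡ b)

  sameEdge? : ∀ e f → Dec (SameEdge e f)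
  sameEdge? (x , y) (a , b) = ((x ≟ a) ×-dec (y ≟ b)) ⊎-dec ((y ≟ a) ×-dec (x ≟ b))

  DistinctEdges : List (Edge n) → Set
  DistinctEdges = AllPairs (λ e f → ¬ SameEdge e f)

  Avoids : Fin n → Edge n → Set
  Avoids z (a , b) = z ≢ a × z ≢ b

  outside-left : ∀ {x y e} → Avoids x e → ¬ SameEdge (x , y) e
  outside-left (x≢a , _) (inj₁ (x≡a , _)) = x≢a x≡a
  outside-left (_ , x≢b) (inj₂ (_ , x≡b)) = x≢b x≡b

  outside-right : ∀ {x y e} → Avoids y e → ¬ SameEdge (x , y) e
  outside-right (_ , y≢b) (inj₁ (_ , y≡b)) = y≢b y≡b
  outside-right (y≢a , _) (inj₂ (y≡a , _)) = y≢a y≡a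

  pathEdges : List (Fin n) → List (Edge n)
  pathEdges (x ∷ y ∷ ws) = (x , y) ∷ pathEdges (y ∷ ws)
  pathEdges _            = []

  avoids-pathEdges : ∀ {z ws} → All (z ≢_) ws → All (Avoids z) (pathEdges ws)
  avoids-pathEdges []                  = []
  avoids-pathEdges (_ ∷ [])            = []
  avoids-pathEdges (z≢x ∷ z≢y ∷ z∉ws) = (z≢x , z≢y) ∷ avoids-pathEdges (z≢y ∷ z∉ws)

  pathEdges-distinct : ∀ {ws} → AllPairs _≢_ ws → DistinctEdges (pathEdges ws)
  pathEdges-distinct []                       = []
  pathEdges-distinct (_ ∷ [])                 = []
  pathEdges-distinct (x∉ws ∷ distinct@(_ ∷ _)) =
    All.map outside-left (avoids-pathEdges x∉ws) ∷ pathEdges-distinct distinct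

module _ {n : ℕ} (G : Graph n) where
  open Graph G

  Adj-sym : ∀ {u v} → Adj G u v → Adj G v u
  Adj-sym {u} {v} uv = trans (adj-sym v u) uv

  Adj-irrefl : ∀ {u v} → Adj G u v → u ≢ v
  Adj-irrefl {u} uv refl with trans (sym uv) (adj-irrefl u)
  ... | ()

  Γ⇒Adj : ∀ {u v} → InΓ G u v → Adj G u v
  Γ⇒Adj = ∧-conicalˡ _ _

  Γ-irrefl : ∀ {u v} → InΓ G u v → u ≢ v
  Γ-irrefl = Adj-irrefl ∘ Γ⇒Adj

  common-neighbour⇒inTriangle : ∀ {u v w} → Adj G u w → Adj G v w → inTriangle G u v ≡ true
  common-neighbour⇒inTriangle {u} {v} uw vw = anyF-intro (λ x → adj u x ∧ adj v x) (∧-intro uw vw)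

  Γ-no-common-neighbour : ∀ {u v w} → InΓ G u v → Adj G u w → Adj G v w → ⊥
  Γ-no-common-neighbour {u} {v} uv uw vw
    with trans (sym (cong not (common-neighbour⇒inTriangle uw vw))) (∧-conicalʳ (adj u v) _ uv)
  ... | ()

  Γ-intro : ∀ {u v} → Adj G u v → (∀ {w} → Adj G u w → Adj G v w → ⊥) → InΓ G u v
  Γ-intro {u} {v} uv no-common with inTriangle G u v in t
  ... | true  = let _ , uw∧vw = anyF-witness (λ x → adj u x ∧ adj v x) t in
                ⊥-elim (no-common (∧-conicalˡ (adj u _) _ uw∧vw) (∧-conicalʳ _ (adj v _) uw∧vw))
  ... | false rewrite uv = refl

  Γ-sym : ∀ {u v} → InΓ G u v → InΓ G v u
  Γ-sym uv = Γ-intro (Adj-sym (Γ⇒Adj uv)) (λ vw uw → Γ-no-common-neighbour uv uw vw)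

  triangle-partner : ∀ {u x} → Adj G u x → gamma G u x ≡ false → ∃ λ w → Adj G u w × Adj G x w
  triangle-partner {u} {x} ux notΓ with inTriangle G u x in t
  ... | true  = let w , uw∧xw = anyF-witness (λ y → adj u y ∧ adj x y) t in
                w , ∧-conicalˡ (adj u w) _ uw∧xw , ∧-conicalʳ _ (adj x w) uw∧xw
  ... | false with trans (sym (cong (_∧ true) ux)) notΓ
  ... | ()

  common-neighbour-unique : C4Free G → ∀ {x y u w} → x ≢ y →
    Adj G u x → Adj G u y → Adj G w x → Adj G w y → u ≡ w
  common-neighbour-unique c4f {x} {y} {u} {w} x≢y ux uy wx wy with u ≟ w
  ... | yes u≡w = u≡w
  ... | no u≢w  = ⊥-elim (c4f (u , x , w , y ,
          (Adj-irrefl ux , u≢w , Adj-irrefl uy , ≢-sym (Adj-irrefl wx) , x≢y , Adj-irrefl wy) ,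
          (ux , Adj-sym wx , wy , Adj-sym uy)))

  -- Opaque so that `with` over terms built from it (such as `extend` below) does not unfold
  -- this proof, which makes type-checking blow up.
  opaque
    another-Γ-edge : C4Free G → ∀ {u v} → InΓ G u v → deg G u ≡ 4 → ∃ λ w → InΓ G u w × w ≢ v
    another-Γ-edge c4f {u} {v} uv deg4
      with enumerate (without (adj u) v) 3
             (suc-injective (trans (sym (countF-without (adj u) v (Γ⇒Adj uv))) deg4))
    ... | a ∷ b ∷ c ∷ [] , (a∉ ∷ b∉ ∷ _) , (a′ ∷ b′ ∷ c′ ∷ []) , complete
      with without-true (adj u) a′ | without-true (adj u) b′ | without-true (adj u) c′
    ... | a≢v , ua | b≢v , ub | c≢v , uc
      with gamma G u a in Γa | gamma G u b in Γb | gamma G u c in Γc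
    ... | true  | _     | _     = a , Γa , a≢v
    ... | false | true  | _     = b , Γb , b≢v
    ... | false | false | true  = c , Γc , c≢v
    ... | false | false | false = ⊥-elim (crowded (partner-a Γa) (partner-b Γb) (partner-c Γc))
      where
      a≢b : a ≢ b
      a≢b = VecAll.head a∉
      a≢c : a ≢ c
      a≢c = VecAll.head (VecAll.tail a∉)
      b≢c : b ≢ c
      b≢c = VecAll.head b∉

      -- A triangle on ux cannot pass through v, since uv lies in no triangle.
      partner : ∀ {x} → Adj G u x → gamma G u x ≡ false →
                ∃ λ w → Adj G x w × w VecMembership.∈ a ∷ b ∷ c ∷ []
      partner ux notΓ with triangle-partner ux notΓ
      ... | w , uw , xw = w , xw , complete (without-intro (adj u) w≢v uw)
        where
        w≢v : w ≢ v
        w≢v refl = Γ-no-common-neighbour uv ux (Adj-sym xw)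

      partner-a : gamma G u a ≡ false → Adj G a b ⊎ Adj G a c
      partner-a notΓ with partner ua notΓ
      ... | _ , aa , here refl                 = ⊥-elim (Adj-irrefl aa refl)
      ... | _ , ab , there (here refl)         = inj₁ ab
      ... | _ , ac , there (there (here refl)) = inj₂ ac

      partner-b : gamma G u b ≡ false → Adj G b a ⊎ Adj G b c
      partner-b notΓ with partner ub notΓ
      ... | _ , ba , here refl                 = inj₁ ba
      ... | _ , bb , there (here refl)         = ⊥-elim (Adj-irrefl bb refl)
      ... | _ , bc , there (there (here refl)) = inj₂ bc

      partner-c : gamma G u c ≡ false → Adj G c a ⊎ Adj G c b
      partner-c notΓ with partner uc notΓ
      ... | _ , ca , here refl                 = inj₁ ca
      ... | _ , cb , there (here refl)         = inj₂ cb
      ... | _ , cc , there (there (here refl)) = ⊥-elim (Adj-irrefl cc refl)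

      two-neighbours : ∀ {x y z} → y ≢ z → Adj G u x → Adj G u y → Adj G u z →
                       Adj G x y → Adj G x z → ⊥
      two-neighbours y≢z ux uy uz xy xz =
        Adj-irrefl ux (common-neighbour-unique c4f y≢z uy uz xy xz)

      crowded : Adj G a b ⊎ Adj G a c → Adj G b a ⊎ Adj G b c → Adj G c a ⊎ Adj G c b → ⊥
      crowded (inj₁ ab) _         (inj₁ ca) = two-neighbours b≢c ua ub uc ab (Adj-sym ca)
      crowded (inj₁ ab) _         (inj₂ cb) = two-neighbours a≢c ub ua uc (Adj-sym ab) (Adj-sym cb)
      crowded (inj₂ ac) (inj₁ ba) _         = two-neighbours b≢c ua ub uc (Adj-sym ba) ac
      crowded (inj₂ ac) (inj₂ bc) _         = two-neighbours a≢b uc ua ub (Adj-sym ac) (Adj-sym bc)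

  ordered-Γ : Fin n → Fin n → Bool
  ordered-Γ u v = (toℕ u <ᵇ toℕ v) ∧ gamma G u v

  Γ-edge-of-tau : ∀ {k} → tau G ≡ suc k → ∃₂ λ x y → InΓ G x y
  Γ-edge-of-tau τ≡ = let x , y , xy = pairCount-witness ordered-Γ τ≡ in
    x , y , ∧-conicalʳ (toℕ x <ᵇ toℕ y) _ xy

  orient : Edge n → Edge n
  orient (a , b) = if toℕ a <ᵇ toℕ b then (a , b) else (b , a)

  orient-Γ : ∀ {e} → uncurry (InΓ G) e → uncurry ordered-Γ (orient e) ≡ true
  orient-Γ {a , b} ab with toℕ a <ᵇ toℕ b in a<ᵇb
  ... | true  = ∧-intro a<ᵇb ab
  ... | false = ∧-intro (Equivalence.to T-≡ (<⇒<ᵇ b<a)) (Γ-sym ab)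
    where
    b<a : toℕ b < toℕ a
    b<a = ≤∧≢⇒< (≮⇒≥ (λ a<b → subst T a<ᵇb (<⇒<ᵇ a<b)))
                 (λ b≡a → Γ-irrefl ab (toℕ-injective (sym b≡a)))

  orient-injective : ∀ e f → orient e ≡ orient f → SameEdge e f
  orient-injective (a , b) (c , d) eq with toℕ a <ᵇ toℕ b | toℕ c <ᵇ toℕ d
  ... | true  | true  = inj₁ (cong proj₁ eq , cong proj₂ eq)
  ... | true  | false = inj₂ (cong proj₂ eq , cong proj₁ eq)
  ... | false | true  = inj₂ (cong proj₁ eq , cong proj₂ eq)
  ... | false | false = inj₁ (cong proj₂ eq , cong proj₁ eq)

  length≤tau : ∀ es → All (uncurry (InΓ G)) es → DistinctEdges es → length es ≤ tau G
  length≤tau es Γes distinct = subst (_≤ tau G) (length-map orient es)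
    (length≤pairCount ordered-Γ (map orient es)
      (All.map⁺ (All.map orient-Γ Γes))
      (AllPairs.map⁺ (AllPairs.map (λ ¬same eq → ¬same (orient-injective _ _ eq)) distinct)))

  data NonBacktracking : List (Fin n) → Set where
    edge : ∀ {x y} → InΓ G x y → NonBacktracking (x ∷ y ∷ [])
    step : ∀ {x y z ws} → InΓ G x y → x ≢ z → NonBacktracking (y ∷ z ∷ ws) →
           NonBacktracking (x ∷ y ∷ z ∷ ws)

  walk-Γ : ∀ {ws} → NonBacktracking ws → All (uncurry (InΓ G)) (pathEdges ws)
  walk-Γ (edge xy)        = xy ∷ []
  walk-Γ (step xy _ walk) = xy ∷ walk-Γ walk

  extend : C4Free G → FourRegular G → ∀ {x y ws} → NonBacktracking (x ∷ y ∷ ws) →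
           ∃ λ z → NonBacktracking (z ∷ x ∷ y ∷ ws)
  extend c4f reg {x} walk with another-Γ-edge c4f (All.head (walk-Γ walk)) (reg x)
  ... | z , xz , z≢y = z , step (Γ-sym xz) z≢y walk

  six-vertex-walk : C4Free G → FourRegular G → ∀ {x y} → InΓ G x y →
    ∃₂ λ x₀ x₁ → ∃₂ λ x₂ x₃ → NonBacktracking (x₀ ∷ x₁ ∷ x₂ ∷ x₃ ∷ x ∷ y ∷ [])
  six-vertex-walk c4f reg xy =
    let x₃ , walk₃ = extend c4f reg (edge xy)
        x₂ , walk₂ = extend c4f reg walk₃
        x₁ , walk₁ = extend c4f reg walk₂
        x₀ , walk₀ = extend c4f reg walk₁
    in x₀ , x₁ , x₂ , x₃ , walk₀

  Γ-triangle-free : ∀ {a b c d} → InΓ G a b → Adj G b c → Adj G c d → a ≢ d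
  Γ-triangle-free ab bc cd refl = Γ-no-common-neighbour ab (Adj-sym cd) bc

  five-vertices-distinct : C4Free G → ∀ {x₀ x₁ x₂ x₃ x₄ ws} →
    NonBacktracking (x₀ ∷ x₁ ∷ x₂ ∷ x₃ ∷ x₄ ∷ ws) → AllPairs _≢_ (x₀ ∷ x₁ ∷ x₂ ∷ x₃ ∷ x₄ ∷ [])
  five-vertices-distinct c4f {x₀} {x₁} {x₂} {x₃} {x₄}
    (step e₀₁ x₀≢x₂ (step e₁₂ x₁≢x₃ (step e₂₃ x₂≢x₄ walk))) =
    (Γ-irrefl e₀₁ ∷ x₀≢x₂ ∷ x₀≢x₃ ∷ x₀≢x₄ ∷ []) ∷
    (Γ-irrefl e₁₂ ∷ x₁≢x₃ ∷ Γ-triangle-free e₁₂ (Γ⇒Adj e₂₃) (Γ⇒Adj e₃₄) ∷ []) ∷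
    (Γ-irrefl e₂₃ ∷ x₂≢x₄ ∷ []) ∷
    (Γ-irrefl e₃₄ ∷ []) ∷ [] ∷ []
    where
    e₃₄ : InΓ G x₃ x₄
    e₃₄ = All.head (walk-Γ walk)
    x₀≢x₃ : x₀ ≢ x₃
    x₀≢x₃ = Γ-triangle-free e₀₁ (Γ⇒Adj e₁₂) (Γ⇒Adj e₂₃)
    -- x₀ = x₄ would make x₀ and x₂ two common neighbours of x₁ and x₃.
    x₀≢x₄ : x₀ ≢ x₄
    x₀≢x₄ refl = x₀≢x₂ (common-neighbour-unique c4f x₁≢x₃
      (Γ⇒Adj e₀₁) (Adj-sym (Γ⇒Adj e₃₄)) (Adj-sym (Γ⇒Adj e₁₂)) (Γ⇒Adj e₂₃))

  six-vertex-walk-edges-distinct : C4Free G → ∀ {x₀ x₁ x₂ x₃ x₄ x₅} →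
    NonBacktracking (x₀ ∷ x₁ ∷ x₂ ∷ x₃ ∷ x₄ ∷ x₅ ∷ []) →
    DistinctEdges (pathEdges (x₀ ∷ x₁ ∷ x₂ ∷ x₃ ∷ x₄ ∷ x₅ ∷ []))
  six-vertex-walk-edges-distinct c4f walk@(step _ _ walk′)
    with five-vertices-distinct c4f walk | five-vertices-distinct c4f walk′
  ... | (x₀≢x₁ ∷ x₀≢x₂ ∷ x₀≢x₃ ∷ x₀≢x₄ ∷ []) ∷ _ | distinct@((_ ∷ _ ∷ x₁≢x₄ ∷ x₁≢x₅ ∷ []) ∷ _) =
    (outside-left (x₀≢x₁ , x₀≢x₂) ∷ outside-left (x₀≢x₂ , x₀≢x₃) ∷
     outside-left (x₀≢x₃ , x₀≢x₄) ∷ outside-right (x₁≢x₄ , x₁≢x₅) ∷ []) ∷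
    pathEdges-distinct distinct

  seven-vertex-walk-six-edges : C4Free G → ∀ {y x₀ x₁ x₂ x₃ x₄ x₅} →
    NonBacktracking (y ∷ x₀ ∷ x₁ ∷ x₂ ∷ x₃ ∷ x₄ ∷ x₅ ∷ []) → x₀ ≢ x₅ → 6 ≤ tau G
  seven-vertex-walk-six-edges c4f {x₀ = x₀} {x₁} {x₂} {x₃} {x₄} {x₅}
    walk@(step _ _ walk₀@(step _ _ walk₁)) x₀≢x₅
    with five-vertices-distinct c4f walk | five-vertices-distinct c4f walk₀
  ... | (y≢x₀ ∷ y≢x₁ ∷ _) ∷ _ | (x₀≢x₁ ∷ x₀≢x₂ ∷ x₀≢x₃ ∷ x₀≢x₄ ∷ []) ∷ _ =
    length≤tau _ (walk-Γ walk)
      ((outside-left (y≢x₀ , y≢x₁) ∷ All.map outside-right (avoids-pathEdges x₀∉)) ∷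
       pathEdges-distinct (x₀∉ ∷ five-vertices-distinct c4f walk₁))
    where
    x₀∉ : All (x₀ ≢_) (x₁ ∷ x₂ ∷ x₃ ∷ x₄ ∷ x₅ ∷ [])
    x₀∉ = x₀≢x₁ ∷ x₀≢x₂ ∷ x₀≢x₃ ∷ x₀≢x₄ ∷ x₀≢x₅ ∷ []

  closed-walk-is-C5 : C4Free G → tau G ≡ 5 → ∀ {x₀ x₁ x₂ x₃ x₄} →
    NonBacktracking (x₀ ∷ x₁ ∷ x₂ ∷ x₃ ∷ x₄ ∷ x₀ ∷ []) → ΓIsC5 G
  closed-walk-is-C5 c4f τ≡5 {x₀} {x₁} {x₂} {x₃} {x₄}
    walk@(step e₀₁ _ (step e₁₂ _ (step e₂₃ _ (step e₃₄ _ (edge e₄₀))))) =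
    lookup cycle , lookup-injective (five-vertices-distinct c4f walk) , on-cycle , cycle-Γ
    where
    cycle : List (Fin n)
    cycle = x₀ ∷ x₁ ∷ x₂ ∷ x₃ ∷ x₄ ∷ []

    cycle-Γ : ∀ i → InΓ G (lookup cycle i) (lookup cycle (cyc5 G i))
    cycle-Γ zero                         = e₀₁
    cycle-Γ (suc zero)                   = e₁₂
    cycle-Γ (suc (suc zero))             = e₂₃
    cycle-Γ (suc (suc (suc zero)))       = e₃₄
    cycle-Γ (suc (suc (suc (suc zero)))) = e₄₀

    on-cycle : ∀ x y → InΓ G x y →
               ∃ λ i → SameEdge (x , y) (lookup cycle i , lookup cycle (cyc5 G i))
    on-cycle x y xy with Any.any? (sameEdge? (x , y)) (pathEdges (x₀ ∷ x₁ ∷ x₂ ∷ x₃ ∷ x₄ ∷ x₀ ∷ []))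
    ... | yes (here same)                                 = zero , same
    ... | yes (there (here same))                         = suc zero , same
    ... | yes (there (there (here same)))                 = suc (suc zero) , same
    ... | yes (there (there (there (here same))))         = suc (suc (suc zero)) , same
    ... | yes (there (there (there (there (here same))))) = suc (suc (suc (suc zero))) , same
    ... | no elsewhere = ⊥-elim (<-irrefl refl (subst (6 ≤_) τ≡5 (length≤tau ((x , y) ∷ _)
            (xy ∷ walk-Γ walk) (¬Any⇒All¬ _ elsewhere ∷ six-vertex-walk-edges-distinct c4f walk))))

lemma2 : ∀ (n : ℕ) (G : Graph n) → Planar G → C4Free G →
    ((FourRegular G → tau G ≡ 0 ⊎ 5 ≤ tau G) ×
     (FourRegular G → tau G ≡ 5 → ΓIsC5 G) ×
     (MinDegAtLeast G 4 → ∀ (u v : Fin n) → InΓ G u v → deg G u ≡ 4 →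
        ∃ λ (w : Fin n) → InΓ G u w × w ≢ v))
lemma2 n G _ c4f = none-or-five , five-is-pentagon , λ _ u v uv deg4 → another-Γ-edge G c4f uv deg4
  where
  none-or-five : FourRegular G → tau G ≡ 0 ⊎ 5 ≤ tau G
  none-or-five reg with tau G in τ≡
  ... | zero  = inj₁ refl
  ... | suc _ with Γ-edge-of-tau G τ≡
  ... | _ , _ , xy with six-vertex-walk G c4f reg xy
  ... | _ , _ , _ , _ , walk =
    inj₂ (subst (5 ≤_) τ≡
      (length≤tau G _ (walk-Γ G walk) (six-vertex-walk-edges-distinct G c4f walk)))

  five-is-pentagon : FourRegular G → tau G ≡ 5 → ΓIsC5 G
  five-is-pentagon reg τ≡5 with Γ-edge-of-tau G τ≡5
  ... | _ , y , xy with six-vertex-walk G c4f reg xy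
  ... | x₀ , _ , _ , _ , walk with x₀ ≟ y
  ... | yes refl = closed-walk-is-C5 G c4f τ≡5 walk
  ... | no x₀≢y  = ⊥-elim (<-irrefl refl (subst (6 ≤_) τ≡5
                     (seven-vertex-walk-six-edges G c4f (proj₂ (extend G c4f reg walk)) x₀≢y)))
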